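{- Every $\mathbf{B}_h$-consistent set of $\mathcal{H}_\beta(@)$-formulas is satisfiable (in the language expanded by countably many fresh nominals) in a countable named model whose underlying frame validates every betweenness axiom of $\mathbf{B}_h$, i.e. each of (HB1)–(HB7) and (HB8$'$). Hence every $\mathbf{B}_h$-consistent set of formulas is satisfiable on a model based on a countable frame from the class $\mathsf{DLBWE}$.
   Context: A 3-frame is $\mathfrak F=\langle W,B\rangle$ with $B\subseteq W^3$; $B(x,y,z)$ is read "$y$ lies between $x$ and $z$", and $\#(x,y,z)$ means $x,y,z$ are pairwise distinct. $\mathsf{DLBWE}$ is the class of 3-frames satisfying (universal closures of): (B1) $B(x,y,z)\to\#(x,y,z)$; (B2) $B(x,y,z)\to B(z,y,x)$; (B3) $B(x,y,z)\to\neg B(x,z,y)$; (B4) $B(x,y,z)\wedge B(y,z,u)\to B(x,y,u)$; (B5) $B(x,y,z)\wedge B(y,u,z)\to B(x,y,u)$; (B6) $\#(x,y,z)\to B(x,y,z)\vee B(x,z,y)\vee B(y,x,z)$; (B7) $\forall y\exists x\exists z\,B(x,y,z)$; (B8) $x\neq z\to\exists y\,B(x,y,z)$. The language $\mathcal H_\beta(@)$ is built from disjoint countable sets $\mathrm{Var}$ of propositional variables and $\mathrm{Nom}$ of nominals: $\varphi::=\top\mid p\mid i\mid\neg\varphi\mid\varphi\wedge\psi\mid\langle B\rangle(\varphi,\psi)\mid @_i\varphi$ (other Boolean connectives as abbreviations). A valuation on $\mathfrak F$ is $V:\mathrm{Var}\cup\mathrm{Nom}\to 2^W$ with $V(i)$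 a singleton for each nominal; a model is $\langle\mathfrak F,V\rangle$. Truth: $w\Vdash p$ iff $w\in V(p)$; $w\Vdash i$ iff $V(i)=\{w\}$; Booleans as usual; $w\Vdash\langle B\rangle(\varphi,\psi)$ iff there are $x,y\in W$ with $x\Vdash\varphi$, $y\Vdash\psi$ and $B(x,w,y)$; $w\Vdash @_i\varphi$ iff the element of $V(i)$ satisfies $\varphi$. Validity on a frame: truth at all points under all valuations. A model is named if every point is the value of some nominal. Write $[B](\varphi,\psi)$ for the dual of $\langle B\rangle$ and $\mathsf C\varphi:=\langle B\rangle(\varphi,\varphi)$. The logic $\mathbf B_h$ has axioms: all propositional tautologies; $\neg\langle B\rangle(p,q)\leftrightarrow[B](\neg p,\neg q)$; $[B](p\to q,r)\to([B](p,r)\to[B](q,r))$; $[B](r,p\to q)\to([B](r,p)\to[B](r,q))$; $@_i(p\to q)\to(@_ip\to @_iq)$; $\neg @_ip\leftrightarrow @_i\neg p$; $@_ii$; $i\wedge p\to @_ip$; $\langle B\rangle(@_ip,q)\to @_ip$; $\langle B\rangle(q,@_ip)\to @_ip$; $@_i@_jp\to @_jp$; $@_ji\to @_ij$; $@_ij\wedge @_jp\to @_ip$; and the betweenness axioms (HB1) $@_i\langle B\rangle(j,k)\to\neg @_ij\wedge\neg @_ik\wedge\neg @_kj$; (HB2) $\langle B\rangle(i,j)\to\langle B\rangle(j,i)$; (HB3) $@_j\langle B\rangle(i,k)\to\neg @_k\langle B\rangle(i,j)$; (HB4) $@_j\langle B\rangle(i,k)\wedge @_k\langle B\rangle(j,l)\to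 @_j\langle B\rangle(i,l)\wedge @_k\langle B\rangle(i,l)$; (HB5) $@_j\langle B\rangle(i,k)\wedge @_l\langle B\rangle(i,j)\to @_l\langle B\rangle(i,k)\wedge @_j\langle B\rangle(l,k)$; (HB6) $\neg @_ij\wedge\neg @_ik\wedge\neg @_kj\to @_j\langle B\rangle(i,k)\vee @_k\langle B\rangle(i,j)\vee @_i\langle B\rangle(j,k)$; (HB7) $\langle B\rangle(\top,\top)$; (HB8$'$) $\langle B\rangle(i,j)\to\mathsf C\mathsf C(i\vee j)$. Rules: modus ponens; from $\vdash\varphi$ infer $\vdash[B](\varphi,\psi)$; from $\vdash\psi$ infer $\vdash[B](\varphi,\psi)$; from $\vdash\varphi$ infer $\vdash @_i\varphi$; uniform substitution (formulas for variables, nominals for nominals); Name: from $\vdash i\to\theta$ infer $\vdash\theta$ if $i$ does not occur in $\theta$; Paste: from $\vdash @_i\langle B\rangle(j,k)\wedge @_j\varphi\wedge @_k\psi\to\theta$ infer $\vdash @_i\langle B\rangle(\varphi,\psi)\to\theta$, provided $i,j,k$ are pairwise distinct and $j,k$ do not occur in $\varphi,\psi,\theta$. -}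

module Defs where

open import Level using (0ℓ)
open import Data.Nat using (ℕ)
open import Data.Bool using (Bool; true; false; not; _∧_)
open import Data.Sum using (_⊎_; inj₁; inj₂)
open import Data.Product using (Σ; _×_; _,_)
open import Data.List using (List; []; _∷_)
open import Data.List.Relation.Unary.All using (All)
open import Data.Empty using (⊥)
open import Data.Unit using () renaming (⊤ to Unit)
open import Relation.Nullary using (¬_)
open import Relation.Binary.PropositionalEquality using (_≡_; _≢_)
open import Function.Definitions using (Injective)

-- Propositional variables are indexed by ℕ; the
-- set of nominals is a parameter N (the base language uses N = ℕ, the
-- language expanded by countably many fresh nominals uses N = ℕ ⊎ ℕ,
-- the original nominals being the inj₁ ones).

data Form (N : Set) : Set where
  ⊤ᶠ  : Form N
  var : ℕ → Form N
  nom : N → Form N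
  ¬ᶠ_ : Form N → Form N
  _∧ᶠ_ : Form N → Form N → Form N
  ⟨B⟩ : Form N → Form N → Form N
  at  : N → Form N → Form N

infixr 6 _∧ᶠ_
infix 7 ¬ᶠ_

module _ {N : Set} where
  infixr 5 _∨ᶠ_
  infixr 4 _⇒_ _⇔_

  ⊥ᶠ : Form N
  ⊥ᶠ = ¬ᶠ ⊤ᶠ

  _∨ᶠ_ : Form N → Form N → Form N
  φ ∨ᶠ ψ = ¬ᶠ ((¬ᶠ φ) ∧ᶠ (¬ᶠ ψ))

  _⇒_ : Form N → Form N → Form N
  φ ⇒ ψ = ¬ᶠ (φ ∧ᶠ (¬ᶠ ψ))

  _⇔_ : Form N → Form N → Form N
  φ ⇔ ψ = (φ ⇒ ψ) ∧ᶠ (ψ ⇒ φ)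

  [B] : Form N → Form N → Form N
  [B] φ ψ = ¬ᶠ ⟨B⟩ (¬ᶠ φ) (¬ᶠ ψ)

  C : Form N → Form N
  C φ = ⟨B⟩ φ φ

  conj : List (Form N) → Form N
  conj []       = ⊤ᶠ
  conj (φ ∷ φs) = φ ∧ᶠ conj φs

  -- propositional tautologies: formulas true under every Boolean
  -- assignment to their maximal non-Boolean subformulas
  evalB : (Form N → Bool) → Form N → Bool
  evalB v ⊤ᶠ        = true
  evalB v (¬ᶠ φ)    = not (evalB v φ)
  evalB v (φ ∧ᶠ ψ)  = evalB v φ ∧ evalB v ψ
  evalB v (var p)   = v (var p)
  evalB v (nom i)   = v (nom i)
  evalB v (⟨B⟩ φ ψ) = v (⟨B⟩ φ ψ)
  evalB v (at i φ)  = v (at i φ)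

  Tautology : Form N → Set
  Tautology φ = (v : Form N → Bool) → evalB v φ ≡ true

  subst : (ℕ → Form N) → (N → N) → Form N → Form N
  subst σ τ ⊤ᶠ        = ⊤ᶠ
  subst σ τ (var p)   = σ p
  subst σ τ (nom i)   = nom (τ i)
  subst σ τ (¬ᶠ φ)    = ¬ᶠ subst σ τ φ
  subst σ τ (φ ∧ᶠ ψ)  = subst σ τ φ ∧ᶠ subst σ τ ψ
  subst σ τ (⟨B⟩ φ ψ) = ⟨B⟩ (subst σ τ φ) (subst σ τ ψ)
  subst σ τ (at i φ)  = at (τ i) (subst σ τ φ)

  Occurs : N → Form N → Set
  Occurs i ⊤ᶠ        = ⊥
  Occurs i (var p)   = ⊥
  Occurs i (nom j)   = i ≡ j
  Occurs i (¬ᶠ φ)    = Occurs i φ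
  Occurs i (φ ∧ᶠ ψ)  = Occurs i φ ⊎ Occurs i ψ
  Occurs i (⟨B⟩ φ ψ) = Occurs i φ ⊎ Occurs i ψ
  Occurs i (at j φ)  = i ≡ j ⊎ Occurs i φ

mapNom : {N M : Set} → (N → M) → Form N → Form M
mapNom f ⊤ᶠ        = ⊤ᶠ
mapNom f (var p)   = var p
mapNom f (nom i)   = nom (f i)
mapNom f (¬ᶠ φ)    = ¬ᶠ mapNom f φ
mapNom f (φ ∧ᶠ ψ)  = mapNom f φ ∧ᶠ mapNom f ψ
mapNom f (⟨B⟩ φ ψ) = ⟨B⟩ (mapNom f φ) (mapNom f ψ)
mapNom f (at i φ)  = at (f i) (mapNom f φ)

embed : Form ℕ → Form (ℕ ⊎ ℕ)
embed = mapNom inj₁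

-- The axioms of B_h (base language, N = ℕ), with the schematic letters
-- p,q,r = variables 0,1,2 and i,j,k,l = nominals 0,1,2,3.

private
  p q r : Form ℕ
  p = var 0
  q = var 1
  r = var 2
  i j k l : Form ℕ
  i = nom 0
  j = nom 1
  k = nom 2
  l = nom 3

at₀ at₁ at₂ at₃ : Form ℕ → Form ℕ
at₀ = at 0
at₁ = at 1
at₂ = at 2
at₃ = at 3

HB1 HB2 HB3 HB4 HB5 HB6 HB7 HB8' : Form ℕ
HB1  = at₀ (⟨B⟩ j k) ⇒ ((¬ᶠ at₀ j) ∧ᶠ (¬ᶠ at₀ k) ∧ᶠ (¬ᶠ at₂ j))
HB2  = ⟨B⟩ i j ⇒ ⟨B⟩ j i
HB3  = at₁ (⟨B⟩ i k) ⇒ ¬ᶠ at₂ (⟨B⟩ i j)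
HB4  = (at₁ (⟨B⟩ i k) ∧ᶠ at₂ (⟨B⟩ j l)) ⇒ (at₁ (⟨B⟩ i l) ∧ᶠ at₂ (⟨B⟩ i l))
HB5  = (at₁ (⟨B⟩ i k) ∧ᶠ at₃ (⟨B⟩ i j)) ⇒ (at₃ (⟨B⟩ i k) ∧ᶠ at₁ (⟨B⟩ l k))
HB6  = ((¬ᶠ at₀ j) ∧ᶠ (¬ᶠ at₀ k) ∧ᶠ (¬ᶠ at₂ j))
         ⇒ (at₁ (⟨B⟩ i k) ∨ᶠ at₂ (⟨B⟩ i j) ∨ᶠ at₀ (⟨B⟩ j k))
HB7  = ⟨B⟩ ⊤ᶠ ⊤ᶠ
HB8' = ⟨B⟩ i j ⇒ C (C (i ∨ᶠ j))

BetweennessAxioms : List (Form ℕ)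
BetweennessAxioms = HB1 ∷ HB2 ∷ HB3 ∷ HB4 ∷ HB5 ∷ HB6 ∷ HB7 ∷ HB8' ∷ []

data Axiom : Form ℕ → Set where
  ax-dual   : Axiom (¬ᶠ ⟨B⟩ p q ⇔ [B] (¬ᶠ p) (¬ᶠ q))
  ax-K1     : Axiom ([B] (p ⇒ q) r ⇒ ([B] p r ⇒ [B] q r))
  ax-K2     : Axiom ([B] r (p ⇒ q) ⇒ ([B] r p ⇒ [B] r q))
  ax-Kat     : Axiom (at₀ (p ⇒ q) ⇒ (at₀ p ⇒ at₀ q))
  ax-selfdual : Axiom ((¬ᶠ at₀ p) ⇔ at₀ (¬ᶠ p))
  ax-ref    : Axiom (at₀ i)
  ax-intro  : Axiom ((i ∧ᶠ p) ⇒ at₀ p)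
  ax-back1  : Axiom (⟨B⟩ (at₀ p) q ⇒ at₀ p)
  ax-back2  : Axiom (⟨B⟩ q (at₀ p) ⇒ at₀ p)
  ax-agree  : Axiom (at₀ (at₁ p) ⇒ at₁ p)
  ax-sym    : Axiom (at₁ i ⇒ at₀ j)
  ax-nom    : Axiom ((at₀ j ∧ᶠ at₁ p) ⇒ at₀ p)
  ax-HB1    : Axiom HB1
  ax-HB2    : Axiom HB2
  ax-HB3    : Axiom HB3
  ax-HB4    : Axiom HB4
  ax-HB5    : Axiom HB5
  ax-HB6    : Axiom HB6
  ax-HB7    : Axiom HB7
  ax-HB8'   : Axiom HB8'

infix 2 ⊢_

data ⊢_ : Form ℕ → Set where
  taut  : ∀ {φ} → Tautology φ → ⊢ φ
  axiom : ∀ {φ} → Axiom φ → ⊢ φ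
  mp    : ∀ {φ ψ} → ⊢ (φ ⇒ ψ) → ⊢ φ → ⊢ ψ
  nec₁  : ∀ {φ} ψ → ⊢ φ → ⊢ [B] φ ψ
  nec₂  : ∀ φ {ψ} → ⊢ ψ → ⊢ [B] φ ψ
  nec-at  : ∀ {φ} n → ⊢ φ → ⊢ at n φ
  usub  : ∀ {φ} (σ : ℕ → Form ℕ) (τ : ℕ → ℕ) → ⊢ φ → ⊢ subst σ τ φ
  name  : ∀ {θ} n → ¬ Occurs n θ → ⊢ (nom n ⇒ θ) → ⊢ θ
  paste : ∀ {φ ψ θ} n m o →
          n ≢ m → n ≢ o → m ≢ o →
          ¬ Occurs m φ → ¬ Occurs m ψ → ¬ Occurs m θ →
          ¬ Occurs o φ → ¬ Occurs o ψ → ¬ Occurs o θ →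
          ⊢ ((at n (⟨B⟩ (nom m) (nom o)) ∧ᶠ at m φ ∧ᶠ at o ψ) ⇒ θ) →
          ⊢ (at n (⟨B⟩ φ ψ) ⇒ θ)

Consistent : (Form ℕ → Set) → Set
Consistent Γ = ¬ (Σ (List (Form ℕ)) λ L → All Γ L × (⊢ ¬ᶠ conj L))

record Frame : Set₁ where
  field
    W : Set
    B : W → W → W → Set

-- a model for the language with nominal set N: a frame, a valuation of
-- variables as subsets, and a valuation of nominals as points (V(i) is
-- the singleton {ν i})
record Model (N : Set) : Set₁ where
  field
    frame : Frame
  open Frame frame public
  field
    V : ℕ → W → Set
    ν : N → W

module _ {N : Set} (M : Model N) where
  open Model M

  Sat : W → Form N → Set
  Sat w ⊤ᶠ        = Unit
  Sat w (var p)   = V p w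
  Sat w (nom n)   = ν n ≡ w
  Sat w (¬ᶠ φ)    = ¬ Sat w φ
  Sat w (φ ∧ᶠ ψ)  = Sat w φ × Sat w ψ
  Sat w (⟨B⟩ φ ψ) = Σ W λ x → Σ W λ y → Sat x φ × Sat y ψ × B x w y
  Sat w (at n φ)  = Sat (ν n) φ

  Named : Set
  Named = (w : W) → Σ N λ n → ν n ≡ w

ValidOn : Frame → Form ℕ → Set₁
ValidOn F φ = (V : ℕ → W → Set) (ν : ℕ → W) (w : W) →
              Sat (record { frame = F ; V = V ; ν = ν }) w φ
  where open Frame F

Countable : Set → Set
Countable A = Σ (A → ℕ) λ f → Injective _≡_ _≡_ f

Distinct : {A : Set} → A → A → A → Set
Distinct x y z = x ≢ y × y ≢ z × x ≢ z

record DLBWE (F : Frame) : Set where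
  open Frame F
  field
    B1 : ∀ {x y z} → B x y z → Distinct x y z
    B2 : ∀ {x y z} → B x y z → B z y x
    B3 : ∀ {x y z} → B x y z → ¬ B x z y
    B4 : ∀ {x y z u} → B x y z → B y z u → B x y u
    B5 : ∀ {x y z u} → B x y z → B y u z → B x y u
    B6 : ∀ {x y z} → Distinct x y z → B x y z ⊎ B x z y ⊎ B y x z
    B7 : ∀ y → Σ W λ x → Σ W λ z → B x y z
    B8 : ∀ {x z} → x ≢ z → Σ W λ y → B x y z

SatisfiedIn : Model (ℕ ⊎ ℕ) → (Form ℕ → Set) → Set
SatisfiedIn M Γ = Σ (Model.W M) λ w → (φ : Form ℕ) → Γ φ → Sat M w (embed φ)

SatisfiableOn : Frame → (Form ℕ → Set) → Set₁
SatisfiableOn F Γ =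
  Σ (ℕ → W → Set) λ V → Σ (ℕ → W) λ ν → Σ W λ w →
    (φ : Form ℕ) → Γ φ → Sat (record { frame = F ; V = V ; ν = ν }) w φ
  where open Frame F

-- Copy Γ onto the even nominals and add the odd nominal 1, so that infinitely
-- many nominals stay fresh.  A Lindenbaum construction extends this set to a
-- maximal consistent Δ that, with every @ᵢ⟨B⟩(φ,ψ), contains a Paste witness
-- @ᵢ⟨B⟩(j,k) ∧ @ⱼφ ∧ @ₖψ.  The points of the canonical model are the classes of
-- nominals under @ᵢj ∈ Δ, and B(i,j,k) holds iff @ⱼ⟨B⟩(i,k) ∈ Δ; the witnesses
-- and the bridge principle @ⱼφ → ⟨B⟩(j,ψ) → ⟨B⟩(φ,ψ) give the truth lemma
-- "w ⊨ φ iff @_w φ ∈ Δ".  The model is named, so every pure theorem, in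
-- particular every betweenness axiom, is valid on its frame; validity of these
-- pure axioms forces the frame conditions of DLBWE.
{-# OPTIONS --safe #-}
module Submission where

open import Defs
open import Level using (0ℓ)
open import Axiom.ExcludedMiddle using (ExcludedMiddle)
open import Axiom.DoubleNegationElimination using (em⇒dne)
open import Data.Bool using (Bool; true; false; not; _∧_; T)
open import Data.Bool.Properties using (T-∧; T-≡)
open import Data.Empty using (⊥; ⊥-elim)
open import Data.List using (List; []; _∷_; _++_; length; map; foldl; cartesianProductWith; upTo)
open import Data.List.Properties using (length-map)
open import Data.List.Membership.Propositional using (_∈_)
open import Data.List.Membership.Propositional.Properties
  using (∈-++⁺ˡ; ∈-++⁺ʳ; ∈-map⁺; ∈-cartesianProductWith⁺; ∈-upTo⁺)
open import Data.List.Relation.Unary.Any using (here; there)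
open import Data.List.Relation.Unary.All as All using (All; []; _∷_)
open import Data.List.Relation.Unary.All.Properties using (++⁺)
open import Data.Nat
  using (ℕ; zero; suc; _+_; _*_; _⊔_; ⌊_/2⌋; _≤_; _<_; s≤s; _≤′_; ≤′-refl; ≤′-step)
open import Data.Nat.Induction using (<-rec)
open import Data.Nat.Properties
  using (≤-refl; ≤-trans; ≤-antisym; ≤⇒≯; ≮⇒≥; ≤⇒≤′; n≤1+n; m≤m+n; m≤m⊔n; m≤n⊔m; +-identityʳ;
         even≢odd; n≡⌊n+n/2⌋; anyUpTo?; ≡-irrelevant)
open import Data.Product using (Σ; _×_; _,_; proj₁; proj₂)
open import Data.Sum as Sum using (_⊎_; inj₁; inj₂; [_,_])
open import Data.Unit using (tt) renaming (⊤ to Unit)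
open import Function using (_∘_)
open import Function.Bundles using (Equivalence)
open import Relation.Nullary using (¬_; Dec; yes; no)
open import Relation.Unary using (Pred; Decidable; _∪_; ｛_｝; _⊆_; ⋃)
open import Relation.Binary.PropositionalEquality using (_≡_; _≢_; refl; sym; trans; cong; cong₂)
  renaming (subst to ≡-subst)

Formula : Set
Formula = Form ℕ

infix  9 #_
infix  8 ¬ˢ_
infixr 7 _∧ˢ_
infixr 5 _∨ˢ_
infixr 4 _⇒ˢ_ _⇔ˢ_

data Schema : Set where
  #_   : ℕ → Schema
  ⊤ˢ   : Schema
  ¬ˢ_  : Schema → Schema
  _∧ˢ_ : Schema → Schema → Schema

_⇒ˢ_ _∨ˢ_ _⇔ˢ_ : Schema → Schema → Schema
s ⇒ˢ t = ¬ˢ (s ∧ˢ ¬ˢ t)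
s ∨ˢ t = ¬ˢ (¬ˢ s ∧ˢ ¬ˢ t)
s ⇔ˢ t = (s ⇒ˢ t) ∧ˢ (t ⇒ˢ s)

-- Out-of-range letters read as ⊤ᶠ, resp. true, so that instantiation and
-- evaluation commute unconditionally.
nth : {A : Set} → A → List A → ℕ → A
nth d []       n       = d
nth d (x ∷ xs) zero    = x
nth d (x ∷ xs) (suc n) = nth d xs n

instantiate : Schema → List Formula → Formula
instantiate (# n)    φs = nth ⊤ᶠ φs n
instantiate ⊤ˢ       φs = ⊤ᶠ
instantiate (¬ˢ s)   φs = ¬ᶠ instantiate s φs
instantiate (s ∧ˢ t) φs = instantiate s φs ∧ᶠ instantiate t φs

evalSchema : List Bool → Schema → Bool
evalSchema bs (# n)    = nth true bs n
evalSchema bs ⊤ˢ       = true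
evalSchema bs (¬ˢ s)   = not (evalSchema bs s)
evalSchema bs (s ∧ˢ t) = evalSchema bs s ∧ evalSchema bs t

evalB-instantiate : (v : Formula → Bool) (s : Schema) (φs : List Formula) →
                    evalB v (instantiate s φs) ≡ evalSchema (map (evalB v) φs) s
evalB-instantiate v (# n)    φs = evalB-nth φs n
  where
  evalB-nth : ∀ φs n → evalB v (nth ⊤ᶠ φs n) ≡ nth true (map (evalB v) φs) n
  evalB-nth []       n       = refl
  evalB-nth (φ ∷ φs) zero    = refl
  evalB-nth (φ ∷ φs) (suc n) = evalB-nth φs n
evalB-instantiate v ⊤ˢ       φs = refl
evalB-instantiate v (¬ˢ s)   φs = cong not (evalB-instantiate v s φs)
evalB-instantiate v (s ∧ˢ t) φs = cong₂ _∧_ (evalB-instantiate v s φs) (evalB-instantiate v t φs)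

allAssignments : ℕ → (List Bool → Bool) → Bool
allAssignments zero    g = g []
allAssignments (suc n) g = allAssignments n (g ∘ (true ∷_)) ∧ allAssignments n (g ∘ (false ∷_))

allAssignments-sound : ∀ n g → T (allAssignments n g) → ∀ bs → length bs ≡ n → T (g bs)
allAssignments-sound zero    g ok []           refl = ok
allAssignments-sound (suc n) g ok (true ∷ bs)  refl =
  allAssignments-sound n _ (proj₁ (Equivalence.to T-∧ ok)) bs refl
allAssignments-sound (suc n) g ok (false ∷ bs) refl =
  allAssignments-sound n _ (proj₂ (Equivalence.to (T-∧ {allAssignments n (g ∘ (true ∷_))}) ok)) bs refl

-- Callers leave `valid` implicit: for a tautological schema it normalises to
-- the unit type and is solved by eta.
⊢-schema : (s : Schema) (φs : List Formula) →
           {valid : T (allAssignments (length φs) (λ bs → evalSchema bs s))} →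
           ⊢ instantiate s φs
⊢-schema s φs {valid} = taut λ v → trans (evalB-instantiate v s φs)
  (Equivalence.to T-≡ (allAssignments-sound (length φs) _ valid (map (evalB v) φs) (length-map (evalB v) φs)))

⇒-trans : ∀ {φ ψ χ} → ⊢ φ ⇒ ψ → ⊢ ψ ⇒ χ → ⊢ φ ⇒ χ
⇒-trans {φ} {ψ} {χ} h h′ =
  mp (mp (⊢-schema ((# 0 ⇒ˢ # 1) ⇒ˢ (# 1 ⇒ˢ # 2) ⇒ˢ # 0 ⇒ˢ # 2) (φ ∷ ψ ∷ χ ∷ [])) h) h′

⇔-to : ∀ {φ ψ} → ⊢ φ ⇔ ψ → ⊢ φ ⇒ ψ
⇔-to {φ} {ψ} = mp (⊢-schema ((# 0 ⇔ˢ # 1) ⇒ˢ # 0 ⇒ˢ # 1) (φ ∷ ψ ∷ []))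

⇔-from : ∀ {φ ψ} → ⊢ φ ⇔ ψ → ⊢ ψ ⇒ φ
⇔-from {φ} {ψ} = mp (⊢-schema ((# 0 ⇔ˢ # 1) ⇒ˢ # 1 ⇒ˢ # 0) (φ ∷ ψ ∷ []))

axiomInstance : ∀ {θ} → Axiom θ → (φs : List Formula) (ns : List ℕ) →
                ⊢ subst (nth ⊤ᶠ φs) (nth 0 ns) θ
axiomInstance ax φs ns = usub (nth ⊤ᶠ φs) (nth 0 ns) (axiom ax)

at-K : ∀ n φ ψ → ⊢ at n (φ ⇒ ψ) ⇒ at n φ ⇒ at n ψ
at-K n φ ψ = axiomInstance ax-Kat (φ ∷ ψ ∷ []) (n ∷ [])

at-selfdual : ∀ n φ → ⊢ (¬ᶠ at n φ) ⇔ at n (¬ᶠ φ)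
at-selfdual n φ = axiomInstance ax-selfdual (φ ∷ []) (n ∷ [])

at-refl : ∀ n → ⊢ at n (nom n)
at-refl n = axiomInstance ax-ref [] (n ∷ [])

at-intro : ∀ n φ → ⊢ nom n ∧ᶠ φ ⇒ at n φ
at-intro n φ = axiomInstance ax-intro (φ ∷ []) (n ∷ [])

at-backˡ : ∀ n φ ψ → ⊢ ⟨B⟩ (at n φ) ψ ⇒ at n φ
at-backˡ n φ ψ = axiomInstance ax-back1 (φ ∷ ψ ∷ []) (n ∷ [])

at-backʳ : ∀ n φ ψ → ⊢ ⟨B⟩ ψ (at n φ) ⇒ at n φ
at-backʳ n φ ψ = axiomInstance ax-back2 (φ ∷ ψ ∷ []) (n ∷ [])

at-agree : ∀ m n φ → ⊢ at m (at n φ) ⇒ at n φ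
at-agree m n φ = axiomInstance ax-agree (φ ∷ []) (m ∷ n ∷ [])

at-sym : ∀ m n → ⊢ at n (nom m) ⇒ at m (nom n)
at-sym m n = axiomInstance ax-sym [] (m ∷ n ∷ [])

at-nom : ∀ m n φ → ⊢ at m (nom n) ∧ᶠ at n φ ⇒ at m φ
at-nom m n φ = axiomInstance ax-nom (φ ∷ []) (m ∷ n ∷ [])

⟨B⟩-dual : ∀ φ ψ → ⊢ (¬ᶠ ⟨B⟩ φ ψ) ⇔ [B] (¬ᶠ φ) (¬ᶠ ψ)
⟨B⟩-dual φ ψ = axiomInstance ax-dual (φ ∷ ψ ∷ []) []

[B]-Kˡ : ∀ φ ψ χ → ⊢ [B] (φ ⇒ ψ) χ ⇒ [B] φ χ ⇒ [B] ψ χ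
[B]-Kˡ φ ψ χ = axiomInstance ax-K1 (φ ∷ ψ ∷ χ ∷ []) []

[B]-Kʳ : ∀ φ ψ χ → ⊢ [B] χ (φ ⇒ ψ) ⇒ [B] χ φ ⇒ [B] χ ψ
[B]-Kʳ φ ψ χ = axiomInstance ax-K2 (φ ∷ ψ ∷ χ ∷ []) []

-- Each argument place of ⟨B⟩ is a normal diamond satisfying the back axiom;
-- the bridge lemmas are proved once for such a diamond.
module NormalDiamond
  (◇ □ : Formula → Formula)
  (dual : ∀ φ → ⊢ (¬ᶠ ◇ φ) ⇔ □ (¬ᶠ φ))
  (K    : ∀ φ ψ → ⊢ □ (φ ⇒ ψ) ⇒ □ φ ⇒ □ ψ)
  (nec  : ∀ {φ} → ⊢ φ → ⊢ □ φ)
  (back : ∀ n φ → ⊢ ◇ (at n φ) ⇒ at n φ)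
  where

  □-mono₂ : ∀ {φ ψ χ} → ⊢ φ ⇒ ψ ⇒ χ → ⊢ □ φ ⇒ □ ψ ⇒ □ χ
  □-mono₂ {φ} {ψ} {χ} h = ⇒-trans (mp (K φ (ψ ⇒ χ)) (nec h)) (K ψ χ)

  ◇-split : ∀ {φ ψ χ} → ⊢ φ ⇒ ψ ∨ᶠ χ → ⊢ ◇ φ ⇒ ◇ ψ ∨ᶠ ◇ χ
  ◇-split {φ} {ψ} {χ} h = mp (mp (mp (mp dualise boxed) (dual φ)) (dual ψ)) (dual χ)
    where
    boxed : ⊢ □ (¬ᶠ ψ) ⇒ □ (¬ᶠ χ) ⇒ □ (¬ᶠ φ)
    boxed = □-mono₂ (mp (⊢-schema ((# 0 ⇒ˢ # 1 ∨ˢ # 2) ⇒ˢ ¬ˢ # 1 ⇒ˢ ¬ˢ # 2 ⇒ˢ ¬ˢ # 0)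
                                  (φ ∷ ψ ∷ χ ∷ [])) h)

    dualise : ⊢ (□ (¬ᶠ ψ) ⇒ □ (¬ᶠ χ) ⇒ □ (¬ᶠ φ))
                ⇒ ((¬ᶠ ◇ φ) ⇔ □ (¬ᶠ φ)) ⇒ ((¬ᶠ ◇ ψ) ⇔ □ (¬ᶠ ψ)) ⇒ ((¬ᶠ ◇ χ) ⇔ □ (¬ᶠ χ))
                ⇒ ◇ φ ⇒ ◇ ψ ∨ᶠ ◇ χ
    dualise = ⊢-schema
      ((# 4 ⇒ˢ # 5 ⇒ˢ # 3) ⇒ˢ (¬ˢ # 0 ⇔ˢ # 3) ⇒ˢ (¬ˢ # 1 ⇔ˢ # 4) ⇒ˢ (¬ˢ # 2 ⇔ˢ # 5) ⇒ˢ # 0 ⇒ˢ # 1 ∨ˢ # 2)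
      (◇ φ ∷ ◇ ψ ∷ ◇ χ ∷ □ (¬ᶠ φ) ∷ □ (¬ᶠ ψ) ∷ □ (¬ᶠ χ) ∷ [])

  -- From n ∧ ¬φ → @ₙ¬φ, a ◇-successor named n either satisfies φ or carries
  -- @ₙ¬φ, which the back axiom pulls out of ◇.
  ◇-nominal : ∀ n φ → ⊢ at n φ ⇒ ◇ (nom n) ⇒ ◇ φ
  ◇-nominal n φ = mp (mp (mp conclude split) (back n (¬ᶠ φ))) (at-selfdual n φ)
    where
    split : ⊢ ◇ (nom n) ⇒ ◇ (at n (¬ᶠ φ)) ∨ᶠ ◇ φ
    split = ◇-split (mp (⊢-schema ((# 0 ∧ˢ ¬ˢ # 1 ⇒ˢ # 2) ⇒ˢ # 0 ⇒ˢ # 2 ∨ˢ # 1)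
                                  (nom n ∷ φ ∷ at n (¬ᶠ φ) ∷ [])) (at-intro n (¬ᶠ φ)))

    conclude : ⊢ (◇ (nom n) ⇒ ◇ (at n (¬ᶠ φ)) ∨ᶠ ◇ φ) ⇒ (◇ (at n (¬ᶠ φ)) ⇒ at n (¬ᶠ φ))
                 ⇒ ((¬ᶠ at n φ) ⇔ at n (¬ᶠ φ)) ⇒ at n φ ⇒ ◇ (nom n) ⇒ ◇ φ
    conclude = ⊢-schema
      ((# 1 ⇒ˢ # 3 ∨ˢ # 2) ⇒ˢ (# 3 ⇒ˢ # 4) ⇒ˢ (¬ˢ # 0 ⇔ˢ # 4) ⇒ˢ # 0 ⇒ˢ # 1 ⇒ˢ # 2)
      (at n φ ∷ ◇ (nom n) ∷ ◇ φ ∷ ◇ (at n (¬ᶠ φ)) ∷ at n (¬ᶠ φ) ∷ [])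

bridgeˡ : ∀ n φ ψ → ⊢ at n φ ⇒ ⟨B⟩ (nom n) ψ ⇒ ⟨B⟩ φ ψ
bridgeˡ n φ ψ = NormalDiamond.◇-nominal (λ χ → ⟨B⟩ χ ψ) (λ χ → [B] χ (¬ᶠ ψ))
  (λ χ → ⟨B⟩-dual χ ψ) (λ χ θ → [B]-Kˡ χ θ (¬ᶠ ψ)) (nec₁ (¬ᶠ ψ)) (λ m χ → at-backˡ m χ ψ) n φ

bridgeʳ : ∀ n φ ψ → ⊢ at n ψ ⇒ ⟨B⟩ φ (nom n) ⇒ ⟨B⟩ φ ψ
bridgeʳ n φ ψ = NormalDiamond.◇-nominal (⟨B⟩ φ) ([B] (¬ᶠ φ))
  (⟨B⟩-dual φ) (λ χ θ → [B]-Kʳ χ θ (¬ᶠ φ)) (nec₂ (¬ᶠ φ)) (λ m χ → at-backʳ m χ φ) n ψ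

maxNom : Formula → ℕ
maxNom ⊤ᶠ        = 0
maxNom (var _)   = 0
maxNom (nom n)   = n
maxNom (¬ᶠ φ)    = maxNom φ
maxNom (φ ∧ᶠ ψ)  = maxNom φ ⊔ maxNom ψ
maxNom (⟨B⟩ φ ψ) = maxNom φ ⊔ maxNom ψ
maxNom (at n φ)  = n ⊔ maxNom φ

occurs⇒≤maxNom : ∀ {n} φ → Occurs n φ → n ≤ maxNom φ
occurs⇒≤maxNom (nom n)   refl        = ≤-refl
occurs⇒≤maxNom (¬ᶠ φ)    o           = occurs⇒≤maxNom φ o
occurs⇒≤maxNom (φ ∧ᶠ ψ)  (inj₁ o)    = ≤-trans (occurs⇒≤maxNom φ o) (m≤m⊔n _ _)
occurs⇒≤maxNom (φ ∧ᶠ ψ)  (inj₂ o)    = ≤-trans (occurs⇒≤maxNom ψ o) (m≤n⊔m _ _)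
occurs⇒≤maxNom (⟨B⟩ φ ψ) (inj₁ o)    = ≤-trans (occurs⇒≤maxNom φ o) (m≤m⊔n _ _)
occurs⇒≤maxNom (⟨B⟩ φ ψ) (inj₂ o)    = ≤-trans (occurs⇒≤maxNom ψ o) (m≤n⊔m _ _)
occurs⇒≤maxNom (at n φ)  (inj₁ refl) = m≤m⊔n _ _
occurs⇒≤maxNom (at n φ)  (inj₂ o)    = ≤-trans (occurs⇒≤maxNom φ o) (m≤n⊔m _ _)

maxNoms : List Formula → ℕ
maxNoms []       = 0
maxNoms (φ ∷ φs) = maxNom φ ⊔ maxNoms φs

∈⇒maxNom≤maxNoms : ∀ {φ φs} → φ ∈ φs → maxNom φ ≤ maxNoms φs
∈⇒maxNom≤maxNoms (here refl) = m≤m⊔n _ _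
∈⇒maxNom≤maxNoms (there φ∈) = ≤-trans (∈⇒maxNom≤maxNoms φ∈) (m≤n⊔m _ _)

Fresh : ℕ → Pred Formula 0ℓ → Set
Fresh n Γ = ∀ {φ} → Γ φ → ¬ Occurs n φ

fresh-∪ : ∀ {n Γ Δ} → Fresh n Γ → Fresh n Δ → Fresh n (Γ ∪ Δ)
fresh-∪ frΓ frΔ (inj₁ φ∈Γ) = frΓ φ∈Γ
fresh-∪ frΓ frΔ (inj₂ φ∈Δ) = frΔ φ∈Δ

maxNoms<⇒fresh : ∀ {n} φs → maxNoms φs < n → Fresh n (_∈ φs)
maxNoms<⇒fresh φs lt {φ} φ∈ o = ≤⇒≯ (≤-trans (occurs⇒≤maxNom φ o) (∈⇒maxNom≤maxNoms φ∈)) lt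

fresh-conj : ∀ {n Γ φs} → Fresh n Γ → All Γ φs → ¬ Occurs n (conj φs)
fresh-conj fr (φ∈Γ ∷ _)   (inj₁ o) = fr φ∈Γ o
fresh-conj fr (_ ∷ φs∈Γ) (inj₂ o) = fresh-conj fr φs∈Γ o

-- `Consistent Γ` is definitionally `¬ Inconsistent Γ`.
Inconsistent : Pred Formula 0ℓ → Set
Inconsistent Γ = Σ (List Formula) λ φs → All Γ φs × (⊢ ¬ᶠ conj φs)

Refutes : Pred Formula 0ℓ → Formula → Set
Refutes Γ φ = Σ (List Formula) λ φs → All Γ φs × (⊢ φ ⇒ ¬ᶠ conj φs)

inconsistent-mono : ∀ {Γ Δ} → Γ ⊆ Δ → Inconsistent Γ → Inconsistent Δ
inconsistent-mono Γ⊆Δ (φs , φs∈Γ , ⊢¬φs) = φs , All.map Γ⊆Δ φs∈Γ , ⊢¬φs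

All-∪｛｝-split : ∀ {Γ : Pred Formula 0ℓ} {φ} φs → All (Γ ∪ ｛ φ ｝) φs →
                Σ (List Formula) λ ψs → All Γ ψs × (⊢ φ ∧ᶠ conj ψs ⇒ conj φs)
All-∪｛｝-split {φ = φ} []       []                = [] , [] , ⊢-schema (# 0 ∧ˢ ⊤ˢ ⇒ˢ ⊤ˢ) (φ ∷ [])
All-∪｛｝-split {φ = φ} (χ ∷ φs) (inj₁ χ∈Γ ∷ φs∈) with All-∪｛｝-split φs φs∈
... | ψs , ψs∈Γ , h = χ ∷ ψs , χ∈Γ ∷ ψs∈Γ ,
  mp (⊢-schema ((# 0 ∧ˢ # 2 ⇒ˢ # 3) ⇒ˢ # 0 ∧ˢ # 1 ∧ˢ # 2 ⇒ˢ # 1 ∧ˢ # 3) (φ ∷ χ ∷ conj ψs ∷ conj φs ∷ [])) h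
All-∪｛｝-split {φ = φ} (χ ∷ φs) (inj₂ refl ∷ φs∈) with All-∪｛｝-split φs φs∈
... | ψs , ψs∈Γ , h = ψs , ψs∈Γ ,
  mp (⊢-schema ((# 0 ∧ˢ # 1 ⇒ˢ # 2) ⇒ˢ # 0 ∧ˢ # 1 ⇒ˢ # 0 ∧ˢ # 2) (φ ∷ conj ψs ∷ conj φs ∷ [])) h

inconsistent-∪⇒refutes : ∀ {Γ φ} → Inconsistent (Γ ∪ ｛ φ ｝) → Refutes Γ φ
inconsistent-∪⇒refutes {φ = φ} (φs , φs∈ , ⊢¬φs) with All-∪｛｝-split φs φs∈
... | ψs , ψs∈Γ , h = ψs , ψs∈Γ ,
  mp (mp (⊢-schema ((# 0 ∧ˢ # 1 ⇒ˢ # 2) ⇒ˢ ¬ˢ # 2 ⇒ˢ # 0 ⇒ˢ ¬ˢ # 1) (φ ∷ conj ψs ∷ conj φs ∷ [])) h) ⊢¬φs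

refutes⇒inconsistent : ∀ {Γ φ} → Refutes Γ φ → Γ φ → Inconsistent Γ
refutes⇒inconsistent {φ = φ} (φs , φs∈Γ , h) φ∈Γ =
  φ ∷ φs , φ∈Γ ∷ φs∈Γ , mp (⊢-schema ((# 0 ⇒ˢ ¬ˢ # 1) ⇒ˢ ¬ˢ (# 0 ∧ˢ # 1)) (φ ∷ conj φs ∷ [])) h

conj-++ : ∀ φs ψs → ⊢ conj (φs ++ ψs) ⇒ conj φs ∧ᶠ conj ψs
conj-++ []       ψs = ⊢-schema (# 0 ⇒ˢ ⊤ˢ ∧ˢ # 0) (conj ψs ∷ [])
conj-++ (φ ∷ φs) ψs =
  mp (⊢-schema ((# 1 ⇒ˢ # 2 ∧ˢ # 3) ⇒ˢ # 0 ∧ˢ # 1 ⇒ˢ (# 0 ∧ˢ # 2) ∧ˢ # 3)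
               (φ ∷ conj (φs ++ ψs) ∷ conj φs ∷ conj ψs ∷ [])) (conj-++ φs ψs)

refutes-both⇒inconsistent : ∀ {Γ φ} → Refutes Γ φ → Refutes Γ (¬ᶠ φ) → Inconsistent Γ
refutes-both⇒inconsistent {φ = φ} (φs , φs∈Γ , h) (ψs , ψs∈Γ , h′) =
  φs ++ ψs , ++⁺ φs∈Γ ψs∈Γ ,
  mp (mp (mp (⊢-schema ((# 3 ⇒ˢ # 1 ∧ˢ # 2) ⇒ˢ (# 0 ⇒ˢ ¬ˢ # 1) ⇒ˢ (¬ˢ # 0 ⇒ˢ ¬ˢ # 2) ⇒ˢ ¬ˢ # 3)
                       (φ ∷ conj φs ∷ conj ψs ∷ conj (φs ++ ψs) ∷ []))
             (conj-++ φs ψs)) h) h′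

name-consistent : ∀ {n Γ} → Fresh n Γ → Consistent Γ → Consistent (Γ ∪ ｛ nom n ｝)
name-consistent {n} fr con inc with inconsistent-∪⇒refutes inc
... | φs , φs∈Γ , h = con (φs , φs∈Γ , name n (fresh-conj fr φs∈Γ) h)

pasteWitness : ℕ → ℕ → ℕ → Formula → Formula → Formula
pasteWitness i j k φ ψ = at i (⟨B⟩ (nom j) (nom k)) ∧ᶠ at j φ ∧ᶠ at k ψ

paste-consistent : ∀ {Γ i j k φ ψ} → Fresh j Γ → Fresh k Γ → j ≢ k →
                   Γ (at i (⟨B⟩ φ ψ)) → Consistent Γ → Consistent (Γ ∪ ｛ pasteWitness i j k φ ψ ｝)
paste-consistent {i = i} {j} {k} {φ} {ψ} frj frk j≢k ◇∈Γ con inc with inconsistent-∪⇒refutes inc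
... | φs , φs∈Γ , h = con (refutes⇒inconsistent (φs , φs∈Γ , pasted) ◇∈Γ)
  where
  pasted : ⊢ at i (⟨B⟩ φ ψ) ⇒ ¬ᶠ conj φs
  pasted = paste i j k
    (frj ◇∈Γ ∘ inj₁ ∘ sym) (frk ◇∈Γ ∘ inj₁ ∘ sym) j≢k
    (frj ◇∈Γ ∘ inj₂ ∘ inj₁) (frj ◇∈Γ ∘ inj₂ ∘ inj₂) (fresh-conj frj φs∈Γ)
    (frk ◇∈Γ ∘ inj₂ ∘ inj₁) (frk ◇∈Γ ∘ inj₂ ∘ inj₂) (fresh-conj frk φs∈Γ) h

subst-var≡mapNom : ∀ {N} (τ : N → N) (φ : Form N) → subst var τ φ ≡ mapNom τ φ
subst-var≡mapNom τ ⊤ᶠ        = refl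
subst-var≡mapNom τ (var p)   = refl
subst-var≡mapNom τ (nom n)   = refl
subst-var≡mapNom τ (¬ᶠ φ)    = cong ¬ᶠ_ (subst-var≡mapNom τ φ)
subst-var≡mapNom τ (φ ∧ᶠ ψ)  = cong₂ _∧ᶠ_ (subst-var≡mapNom τ φ) (subst-var≡mapNom τ ψ)
subst-var≡mapNom τ (⟨B⟩ φ ψ) = cong₂ ⟨B⟩ (subst-var≡mapNom τ φ) (subst-var≡mapNom τ ψ)
subst-var≡mapNom τ (at n φ)  = cong (at (τ n)) (subst-var≡mapNom τ φ)

mapNom-inverse : ∀ {N M} {f : N → M} {g : M → N} → (∀ n → g (f n) ≡ n) →
                 ∀ φ → mapNom g (mapNom f φ) ≡ φ
mapNom-inverse inv ⊤ᶠ        = refl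
mapNom-inverse inv (var p)   = refl
mapNom-inverse inv (nom n)   = cong nom (inv n)
mapNom-inverse inv (¬ᶠ φ)    = cong ¬ᶠ_ (mapNom-inverse inv φ)
mapNom-inverse inv (φ ∧ᶠ ψ)  = cong₂ _∧ᶠ_ (mapNom-inverse inv φ) (mapNom-inverse inv ψ)
mapNom-inverse inv (⟨B⟩ φ ψ) = cong₂ ⟨B⟩ (mapNom-inverse inv φ) (mapNom-inverse inv ψ)
mapNom-inverse inv (at n φ)  = cong₂ at (inv n) (mapNom-inverse inv φ)

occurs-mapNom : ∀ {N M} {n : M} (f : N → M) φ → Occurs n (mapNom f φ) → Σ N λ m → f m ≡ n
occurs-mapNom f (nom m)   refl        = m , refl
occurs-mapNom f (¬ᶠ φ)    o           = occurs-mapNom f φ o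
occurs-mapNom f (φ ∧ᶠ ψ)  (inj₁ o)    = occurs-mapNom f φ o
occurs-mapNom f (φ ∧ᶠ ψ)  (inj₂ o)    = occurs-mapNom f ψ o
occurs-mapNom f (⟨B⟩ φ ψ) (inj₁ o)    = occurs-mapNom f φ o
occurs-mapNom f (⟨B⟩ φ ψ) (inj₂ o)    = occurs-mapNom f ψ o
occurs-mapNom f (at m φ)  (inj₁ refl) = m , refl
occurs-mapNom f (at m φ)  (inj₂ o)    = occurs-mapNom f φ o

renamed : (ℕ → ℕ) → Pred Formula 0ℓ → Pred Formula 0ℓ
renamed f Γ φ = Σ Formula λ ψ → Γ ψ × mapNom f ψ ≡ φ

All-renamed-unrename : ∀ {f g Γ} → (∀ n → g (f n) ≡ n) → ∀ φs → All (renamed f Γ) φs →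
                       Σ (List Formula) λ ψs → All Γ ψs × (subst var g (conj φs) ≡ conj ψs)
All-renamed-unrename inv []       []                       = [] , [] , refl
All-renamed-unrename {g = g} inv (_ ∷ φs) ((ψ , ψ∈Γ , refl) ∷ φs∈) with All-renamed-unrename inv φs φs∈
... | ψs , ψs∈Γ , eq = ψ ∷ ψs , ψ∈Γ ∷ ψs∈Γ , cong₂ _∧ᶠ_ (trans (subst-var≡mapNom g _) (mapNom-inverse inv ψ)) eq

renamed-consistent : ∀ {f g Γ} → (∀ n → g (f n) ≡ n) → Consistent Γ → Consistent (renamed f Γ)
renamed-consistent {g = g} inv con (φs , φs∈ , ⊢¬φs) with All-renamed-unrename inv φs φs∈
... | ψs , ψs∈Γ , eq = con (ψs , ψs∈Γ , ≡-subst (λ χ → ⊢ ¬ᶠ χ) eq (usub var g ⊢¬φs))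

renamed-fresh : ∀ {f n Γ} → (∀ m → f m ≢ n) → Fresh n (renamed f Γ)
renamed-fresh {f} f≢n (ψ , _ , refl) o with occurs-mapNom f ψ o
... | m , fm≡n = f≢n m fm≡n

double : ℕ → ℕ
double n = 2 * n

⌊double/2⌋ : ∀ n → ⌊ double n /2⌋ ≡ n
⌊double/2⌋ n = sym (trans (n≡⌊n+n/2⌋ n) (cong (λ m → ⌊ n + m /2⌋) (sym (+-identityʳ n))))

doubled-consistent : ∀ {Γ} → Consistent Γ → Consistent (renamed double Γ)
doubled-consistent = renamed-consistent {g = ⌊_/2⌋} ⌊double/2⌋

odd-fresh-for-doubled : ∀ {Γ} m → Fresh (suc (double m)) (renamed double Γ)
odd-fresh-for-doubled m = renamed-fresh (λ k → even≢odd k m)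

-- Γ moves to the even nominals, leaving the odd ones fresh; nominal 1 will name
-- the point at which Γ holds.
namedCopy : Pred Formula 0ℓ → Pred Formula 0ℓ
namedCopy Γ = renamed double Γ ∪ ｛ nom 1 ｝

namedCopy-consistent : ∀ {Γ} → Consistent Γ → Consistent (namedCopy Γ)
namedCopy-consistent = name-consistent (odd-fresh-for-doubled 0) ∘ doubled-consistent

namedCopy-fresh : ∀ {Γ} m → Σ ℕ λ n → m < n × Fresh n (namedCopy Γ)
namedCopy-fresh {Γ} m = suc (double (suc m)) , s≤s (≤-trans (n≤1+n m) (m≤m+n (suc m) _)) ,
  fresh-∪ {Γ = renamed double Γ} {Δ = ｛ nom 1 ｝} (odd-fresh-for-doubled (suc m)) λ { refl () }

ascending-mono : ∀ {A : Set} (X : ℕ → Pred A 0ℓ) → (∀ d → X d ⊆ X (suc d)) →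
                 ∀ {d e} → d ≤ e → X d ⊆ X e
ascending-mono X step d≤e = go (≤⇒≤′ d≤e)
  where
  go : ∀ {d e} → d ≤′ e → X d ⊆ X e
  go ≤′-refl        x∈ = x∈
  go (≤′-step d≤′e) x∈ = step _ (go d≤′e x∈)

All-⋃-ascending : ∀ {A : Set} (X : ℕ → Pred A 0ℓ) → (∀ {d e} → d ≤ e → X d ⊆ X e) →
                  ∀ {xs} → All (⋃ ℕ X) xs → Σ ℕ λ d → All (X d) xs
All-⋃-ascending X mono []                = 0 , []
All-⋃-ascending X mono ((d , x∈) ∷ xs∈) with All-⋃-ascending X mono xs∈
... | e , xs∈X = d ⊔ e , mono (m≤m⊔n d e) x∈ ∷ All.map (mono (m≤n⊔m d e)) xs∈X

negations conjunctions diamonds : List Formula → List Formula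
negations    φs = map ¬ᶠ_ φs
conjunctions φs = cartesianProductWith _∧ᶠ_ φs φs
diamonds     φs = cartesianProductWith ⟨B⟩ φs φs

ats : ℕ → List Formula → List Formula
ats d φs = cartesianProductWith at (upTo (suc d)) φs

grow : ℕ → List Formula → List Formula
grow d φs = var d ∷ nom d ∷ negations φs ++ conjunctions φs ++ diamonds φs ++ ats d φs

formulas : ℕ → List Formula
formulas zero    = ⊤ᶠ ∷ []
formulas (suc d) = formulas d ++ grow d (formulas d)

formulas-mono : ∀ {d e} → d ≤ e → (_∈ formulas d) ⊆ (_∈ formulas e)
formulas-mono = ascending-mono (λ d → _∈ formulas d) (λ _ → ∈-++⁺ˡ)

module _ {d : ℕ} where
  private
    φs = formulas d

    next : ∀ {φ} → φ ∈ grow d φs → φ ∈ formulas (suc d)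
    next = ∈-++⁺ʳ φs

    skip₁ : ∀ {φ} → φ ∈ conjunctions φs ++ diamonds φs ++ ats d φs → φ ∈ formulas (suc d)
    skip₁ = next ∘ there ∘ there ∘ ∈-++⁺ʳ (negations φs)

    skip₂ : ∀ {φ} → φ ∈ diamonds φs ++ ats d φs → φ ∈ formulas (suc d)
    skip₂ = skip₁ ∘ ∈-++⁺ʳ (conjunctions φs)

  ¬-enumerated : ∀ {φ} → φ ∈ formulas d → ¬ᶠ φ ∈ formulas (suc d)
  ¬-enumerated = next ∘ there ∘ there ∘ ∈-++⁺ˡ ∘ ∈-map⁺ ¬ᶠ_

  ∧-enumerated : ∀ {φ ψ} → φ ∈ formulas d → ψ ∈ formulas d → φ ∧ᶠ ψ ∈ formulas (suc d)
  ∧-enumerated φ∈ ψ∈ = skip₁ (∈-++⁺ˡ (∈-cartesianProductWith⁺ _∧ᶠ_ φ∈ ψ∈))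

  ⟨B⟩-enumerated : ∀ {φ ψ} → φ ∈ formulas d → ψ ∈ formulas d → ⟨B⟩ φ ψ ∈ formulas (suc d)
  ⟨B⟩-enumerated φ∈ ψ∈ = skip₂ (∈-++⁺ˡ (∈-cartesianProductWith⁺ ⟨B⟩ φ∈ ψ∈))

  at-enumerated : ∀ {n φ} → n ≤ d → φ ∈ formulas d → at n φ ∈ formulas (suc d)
  at-enumerated n≤d φ∈ =
    skip₂ (∈-++⁺ʳ (diamonds φs) (∈-cartesianProductWith⁺ at (∈-upTo⁺ (s≤s n≤d)) φ∈))

enumerated : ∀ φ → Σ ℕ λ d → φ ∈ formulas d
enumerated ⊤ᶠ        = 0 , here refl
enumerated (var p)   = suc p , ∈-++⁺ʳ (formulas p) (here refl)
enumerated (nom n)   = suc n , ∈-++⁺ʳ (formulas n) (there (here refl))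
enumerated (¬ᶠ φ)    with enumerated φ
... | d , φ∈ = suc d , ¬-enumerated φ∈
enumerated (φ ∧ᶠ ψ)  with enumerated φ | enumerated ψ
... | d , φ∈ | e , ψ∈ =
  suc (d ⊔ e) , ∧-enumerated (formulas-mono (m≤m⊔n d e) φ∈) (formulas-mono (m≤n⊔m d e) ψ∈)
enumerated (⟨B⟩ φ ψ) with enumerated φ | enumerated ψ
... | d , φ∈ | e , ψ∈ =
  suc (d ⊔ e) , ⟨B⟩-enumerated (formulas-mono (m≤m⊔n d e) φ∈) (formulas-mono (m≤n⊔m d e) ψ∈)
enumerated (at n φ)  with enumerated φ
... | d , φ∈ = suc (n ⊔ d) , at-enumerated (m≤m⊔n n d) (formulas-mono (m≤n⊔m n d) φ∈)

Complete : Pred Formula 0ℓ → Set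
Complete Δ = ∀ φ → Δ φ ⊎ Δ (¬ᶠ φ)

PasteWitnessed : Pred Formula 0ℓ → Formula → Set
PasteWitnessed Δ φ = ∀ {i a b} → φ ≡ at i (⟨B⟩ a b) → Σ ℕ λ j → Σ ℕ λ k → Δ (pasteWitness i j k a b)

Pasted : Pred Formula 0ℓ → Set
Pasted Δ = ∀ {φ} → Δ φ → PasteWitnessed Δ φ

data PasteView : Formula → Set where
  diamond-at : ∀ i a b → PasteView (at i (⟨B⟩ a b))
  other      : ∀ {φ} → PasteView φ

pasteView : ∀ φ → PasteView φ
pasteView (at i (⟨B⟩ a b)) = diamond-at i a b
pasteView φ                = other

-- Every enumerated formula consistent with the current stage is added; a formula
-- @ᵢ⟨B⟩(a,b) comes with its Paste witness, on nominals beyond all those used so far.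
module Lindenbaum (em : ExcludedMiddle 0ℓ) (Γ : Pred Formula 0ℓ) (Γ-consistent : Consistent Γ)
                  (fresh : ∀ m → Σ ℕ λ n → m < n × Fresh n Γ) where

  ⟪_⟫ : List Formula → Pred Formula 0ℓ
  ⟪ acc ⟫ = Γ ∪ (_∈ acc)

  ⟪∷⟫⊆ : ∀ {φ acc} → ⟪ φ ∷ acc ⟫ ⊆ ⟪ acc ⟫ ∪ ｛ φ ｝
  ⟪∷⟫⊆ (inj₁ ψ∈Γ)          = inj₁ (inj₁ ψ∈Γ)
  ⟪∷⟫⊆ (inj₂ (here refl))  = inj₂ refl
  ⟪∷⟫⊆ (inj₂ (there ψ∈))   = inj₁ (inj₂ ψ∈)

  freshFor : List Formula → ℕ
  freshFor acc = proj₁ (fresh (maxNoms acc))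

  freshFor-fresh : ∀ acc → Fresh (freshFor acc) ⟪ acc ⟫
  freshFor-fresh acc with fresh (maxNoms acc)
  ... | _ , above , fresh-Γ = fresh-∪ {Γ = Γ} {Δ = _∈ acc} fresh-Γ (maxNoms<⇒fresh acc above)

  secondFreshFor : List Formula → ℕ
  secondFreshFor acc = freshFor (nom (freshFor acc) ∷ acc)

  secondFreshFor-fresh : ∀ acc → Fresh (secondFreshFor acc) ⟪ acc ⟫
  secondFreshFor-fresh acc ψ∈ = freshFor-fresh (nom (freshFor acc) ∷ acc) (Sum.map₂ there ψ∈)

  freshFor≢secondFreshFor : ∀ acc → freshFor acc ≢ secondFreshFor acc
  freshFor≢secondFreshFor acc j≡k = freshFor-fresh (nom (freshFor acc) ∷ acc) (inj₂ (here refl)) (sym j≡k)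

  extend : (acc : List Formula) (φ : Formula) → PasteView φ → List Formula
  extend acc φ (diamond-at i a b) =
    pasteWitness i (freshFor (φ ∷ acc)) (secondFreshFor (φ ∷ acc)) a b ∷ φ ∷ acc
  extend acc φ other              = φ ∷ acc

  extend-consistent : ∀ {acc φ} (v : PasteView φ) → Consistent ⟪ φ ∷ acc ⟫ → Consistent ⟪ extend acc φ v ⟫
  extend-consistent {acc} {φ} (diamond-at i a b) con =
    paste-consistent (freshFor-fresh (φ ∷ acc)) (secondFreshFor-fresh (φ ∷ acc))
                     (freshFor≢secondFreshFor (φ ∷ acc)) (inj₂ (here refl)) con
    ∘ inconsistent-mono ⟪∷⟫⊆
  extend-consistent other con = con

  step : List Formula → Formula → List Formula
  step acc φ with em {Inconsistent ⟪ φ ∷ acc ⟫}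
  ... | yes _ = acc
  ... | no _  = extend acc φ (pasteView φ)

  step-⊇ : ∀ acc φ → (_∈ acc) ⊆ (_∈ step acc φ)
  step-⊇ acc φ with em {Inconsistent ⟪ φ ∷ acc ⟫}
  ... | yes _ = λ ψ∈ → ψ∈
  ... | no _  = extend-⊇ (pasteView φ)
    where
    extend-⊇ : (v : PasteView φ) → (_∈ acc) ⊆ (_∈ extend acc φ v)
    extend-⊇ (diamond-at i a b) = there ∘ there
    extend-⊇ other              = there

  step-consistent : ∀ acc φ → Consistent ⟪ acc ⟫ → Consistent ⟪ step acc φ ⟫
  step-consistent acc φ con with em {Inconsistent ⟪ φ ∷ acc ⟫}
  ... | yes _   = con
  ... | no con′ = extend-consistent (pasteView φ) con′

  step-decides : ∀ acc φ →
                 Inconsistent ⟪ φ ∷ acc ⟫ ⊎ (φ ∈ step acc φ × PasteWitnessed (_∈ step acc φ) φ)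
  step-decides acc φ with em {Inconsistent ⟪ φ ∷ acc ⟫}
  ... | yes inc = inj₁ inc
  ... | no _    = inj₂ (accepted (pasteView φ) , witnessed)
    where
    accepted : (v : PasteView φ) → φ ∈ extend acc φ v
    accepted (diamond-at i a b) = there (here refl)
    accepted other              = here refl

    witnessed : PasteWitnessed (_∈ extend acc φ (pasteView φ)) φ
    witnessed refl = _ , _ , here refl

  foldl-⊇ : ∀ acc φs → (_∈ acc) ⊆ (_∈ foldl step acc φs)
  foldl-⊇ acc []       = λ ψ∈ → ψ∈
  foldl-⊇ acc (φ ∷ φs) = foldl-⊇ (step acc φ) φs ∘ step-⊇ acc φ

  foldl-consistent : ∀ acc φs → Consistent ⟪ acc ⟫ → Consistent ⟪ foldl step acc φs ⟫
  foldl-consistent acc []       con = con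
  foldl-consistent acc (φ ∷ φs) con = foldl-consistent (step acc φ) φs (step-consistent acc φ con)

  foldl-visits : ∀ acc φs {φ} → φ ∈ φs →
                 Σ (List Formula) λ acc′ → (_∈ step acc′ φ) ⊆ (_∈ foldl step acc φs)
  foldl-visits acc (φ ∷ φs) (here refl) = acc , foldl-⊇ (step acc φ) φs
  foldl-visits acc (ψ ∷ φs) (there φ∈)  = foldl-visits (step acc ψ) φs φ∈

  stage : ℕ → List Formula
  stage zero    = []
  stage (suc d) = foldl step (stage d) (formulas d)

  stage-mono : ∀ {d e} → d ≤ e → ⟪ stage d ⟫ ⊆ ⟪ stage e ⟫
  stage-mono = ascending-mono (λ d → ⟪ stage d ⟫) (λ d → Sum.map₂ (foldl-⊇ (stage d) (formulas d)))

  stage-consistent : ∀ d → Consistent ⟪ stage d ⟫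
  stage-consistent zero    = Γ-consistent ∘ inconsistent-mono [ (λ ψ∈Γ → ψ∈Γ) , (λ ()) ]
  stage-consistent (suc d) = foldl-consistent (stage d) (formulas d) (stage-consistent d)

  Δ : Pred Formula 0ℓ
  Δ = ⋃ ℕ (λ d → ⟪ stage d ⟫)

  Γ⊆Δ : Γ ⊆ Δ
  Γ⊆Δ ψ∈Γ = 0 , inj₁ ψ∈Γ

  Δ-consistent : Consistent Δ
  Δ-consistent (φs , φs∈Δ , ⊢¬φs) with All-⋃-ascending (λ d → ⟪ stage d ⟫) stage-mono φs∈Δ
  ... | d , φs∈ = stage-consistent d (φs , φs∈ , ⊢¬φs)

  decides : ∀ φ → (Σ ℕ λ d → Inconsistent (⟪ stage d ⟫ ∪ ｛ φ ｝)) ⊎ (Δ φ × PasteWitnessed Δ φ)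
  decides φ with enumerated φ
  ... | d , φ∈ with foldl-visits (stage d) (formulas d) φ∈
  ... | acc′ , visited with step-decides acc′ φ
  ... | inj₁ inc = inj₁ (suc d , inconsistent-mono (Sum.map₁ (Sum.map₂ (visited ∘ step-⊇ acc′ φ)) ∘ ⟪∷⟫⊆) inc)
  ... | inj₂ (φ∈ , witnessed) = inj₂ ((suc d , inj₂ (visited φ∈)) , inΔ ∘ witnessed)
    where
    inΔ : ∀ {i a b} → Σ ℕ (λ j → Σ ℕ λ k → pasteWitness i j k a b ∈ step acc′ φ) →
          Σ ℕ λ j → Σ ℕ λ k → Δ (pasteWitness i j k a b)
    inΔ (j , k , w∈) = j , k , suc d , inj₂ (visited w∈)

  Δ-complete : Complete Δ
  Δ-complete φ with decides φ | decides (¬ᶠ φ)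
  ... | inj₂ (φ∈Δ , _) | _               = inj₁ φ∈Δ
  ... | inj₁ _         | inj₂ (¬φ∈Δ , _) = inj₂ ¬φ∈Δ
  ... | inj₁ (d , inc) | inj₁ (e , inc′) = ⊥-elim (stage-consistent (d ⊔ e)
    (refutes-both⇒inconsistent (inconsistent-∪⇒refutes (lift (m≤m⊔n d e) inc))
                               (inconsistent-∪⇒refutes (lift (m≤n⊔m d e) inc′))))
    where
    lift : ∀ {d e ψ} → d ≤ e → Inconsistent (⟪ stage d ⟫ ∪ ｛ ψ ｝) → Inconsistent (⟪ stage e ⟫ ∪ ｛ ψ ｝)
    lift d≤e = inconsistent-mono (Sum.map₁ (stage-mono d≤e))

  Δ-pasted : Pasted Δ
  Δ-pasted {φ} φ∈Δ with decides φ
  ... | inj₁ (d , inc)       = ⊥-elim (Δ-consistent (inconsistent-mono [ (d ,_) , (λ { refl → φ∈Δ }) ] inc))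
  ... | inj₂ (_ , witnessed) = witnessed

model : ∀ {N} (F : Frame) → (ℕ → Frame.W F → Set) → (N → Frame.W F) → Model N
model F V ν = record { frame = F ; V = V ; ν = ν }

module _ {N M : Set} (F : Frame) (V : ℕ → Frame.W F → Set) {ν : M → Frame.W F} {ν′ : N → Frame.W F}
         (f : N → M) (agree : ∀ n → ν′ n ≡ ν (f n)) where

  mutual
    sat-mapNom⁺ : ∀ φ {w} → Sat (model F V ν′) w φ → Sat (model F V ν) w (mapNom f φ)
    sat-mapNom⁺ ⊤ᶠ        s                     = s
    sat-mapNom⁺ (var p)   s                     = s
    sat-mapNom⁺ (nom n)   s                     = trans (sym (agree n)) s
    sat-mapNom⁺ (¬ᶠ φ)    s                     = s ∘ sat-mapNom⁻ φ
    sat-mapNom⁺ (φ ∧ᶠ ψ)  (sφ , sψ)             = sat-mapNom⁺ φ sφ , sat-mapNom⁺ ψ sψ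
    sat-mapNom⁺ (⟨B⟩ φ ψ) (x , y , sφ , sψ , b) = x , y , sat-mapNom⁺ φ sφ , sat-mapNom⁺ ψ sψ , b
    sat-mapNom⁺ (at n φ)  s                     =
      ≡-subst (λ w → Sat (model F V ν) w (mapNom f φ)) (agree n) (sat-mapNom⁺ φ s)

    sat-mapNom⁻ : ∀ φ {w} → Sat (model F V ν) w (mapNom f φ) → Sat (model F V ν′) w φ
    sat-mapNom⁻ ⊤ᶠ        s                     = s
    sat-mapNom⁻ (var p)   s                     = s
    sat-mapNom⁻ (nom n)   s                     = trans (agree n) s
    sat-mapNom⁻ (¬ᶠ φ)    s                     = s ∘ sat-mapNom⁺ φ
    sat-mapNom⁻ (φ ∧ᶠ ψ)  (sφ , sψ)             = sat-mapNom⁻ φ sφ , sat-mapNom⁻ ψ sψ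
    sat-mapNom⁻ (⟨B⟩ φ ψ) (x , y , sφ , sψ , b) = x , y , sat-mapNom⁻ φ sφ , sat-mapNom⁻ ψ sψ , b
    sat-mapNom⁻ (at n φ)  s                     =
      sat-mapNom⁻ φ (≡-subst (λ w → Sat (model F V ν) w (mapNom f φ)) (sym (agree n)) s)

Pure : ∀ {N} → Form N → Set
Pure ⊤ᶠ        = Unit
Pure (var _)   = ⊥
Pure (nom _)   = Unit
Pure (¬ᶠ φ)    = Pure φ
Pure (φ ∧ᶠ ψ)  = Pure φ × Pure ψ
Pure (⟨B⟩ φ ψ) = Pure φ × Pure ψ
Pure (at _ φ)  = Pure φ

sat-pure : ∀ {N} (F : Frame) {V V′ : ℕ → Frame.W F → Set} {ν : N → Frame.W F} φ → Pure φ →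
           ∀ {w} → Sat (model F V ν) w φ → Sat (model F V′ ν) w φ
sat-pure F ⊤ᶠ        _         s                     = s
sat-pure F (nom n)   _         s                     = s
sat-pure F (¬ᶠ φ)    p         s                     = s ∘ sat-pure F φ p
sat-pure F (φ ∧ᶠ ψ)  (pφ , pψ) (sφ , sψ)             = sat-pure F φ pφ sφ , sat-pure F ψ pψ sψ
sat-pure F (⟨B⟩ φ ψ) (pφ , pψ) (x , y , sφ , sψ , b) = x , y , sat-pure F φ pφ sφ , sat-pure F ψ pψ sψ , b
sat-pure F (at n φ)  p         s                     = sat-pure F φ p s

TheoremsTrue : Model ℕ → Set
TheoremsTrue M = ∀ {φ} → ⊢ φ → ∀ w → Sat M w φ

-- Every assignment of nominals on a named model factors through its naming,
-- so a pure theorem, renamed accordingly, is again a theorem true in the model.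
pure-theorem-valid : (M : Model ℕ) → Named M → TheoremsTrue M →
                     ∀ {φ} → ⊢ φ → Pure φ → ValidOn (Model.frame M) φ
pure-theorem-valid M named thms {φ} ⊢φ pure V ν w =
  sat-pure F φ pure (sat-mapNom⁻ F (Model.V M) τ agree φ
    (≡-subst (Sat M w) (subst-var≡mapNom τ φ) (thms (usub var τ ⊢φ) w)))
  where
  F : Frame
  F = Model.frame M
  τ : ℕ → ℕ
  τ n = proj₁ (named (ν n))
  agree : ∀ n → ν n ≡ Model.ν M (τ n)
  agree n = sym (proj₂ (named (ν n)))

betweenness-valid : (M : Model ℕ) → Named M → TheoremsTrue M →
                    All (ValidOn (Model.frame M)) BetweennessAxioms
betweenness-valid M named thms =
  valid ax-HB1 ∷ valid ax-HB2 ∷ valid ax-HB3 ∷ valid ax-HB4 ∷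
  valid ax-HB5 ∷ valid ax-HB6 ∷ valid ax-HB7 ∷ valid ax-HB8' ∷ []
  where
  valid : ∀ {φ} → Axiom φ → {pure : Pure φ} → ValidOn (Model.frame M) φ
  valid ax {pure} = pure-theorem-valid M named thms (axiom ax) pure

Least : (ℕ → Set) → Set
Least P = Σ ℕ λ m → P m × (∀ {n} → P n → m ≤ n)

least : ∀ {P : ℕ → Set} → Decidable P → ∀ {n} → P n → Least P
least {P} P? {n} = <-rec (λ n → P n → Least P) search n
  where
  search : ∀ n → (∀ {m} → m < n → P m → Least P) → P n → Least P
  search n below pn with anyUpTo? P? n
  ... | yes (m , m<n , pm) = below m<n pm
  ... | no none            = n , pn , λ pk → ≮⇒≥ (λ k<n → none (_ , k<n , pk))

module MaximalConsistent (Δ : Pred Formula 0ℓ) (Δ-consistent : Consistent Δ) (Δ-complete : Complete Δ) where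

  Δ-theorem : ∀ {φ} → ⊢ φ → Δ φ
  Δ-theorem {φ} ⊢φ with Δ-complete φ
  ... | inj₁ φ∈  = φ∈
  ... | inj₂ ¬φ∈ = ⊥-elim (Δ-consistent (¬ᶠ φ ∷ [] , ¬φ∈ ∷ [] ,
                     mp (⊢-schema (# 0 ⇒ˢ ¬ˢ (¬ˢ # 0 ∧ˢ ⊤ˢ)) (φ ∷ [])) ⊢φ))

  Δ-mp : ∀ {φ ψ} → Δ (φ ⇒ ψ) → Δ φ → Δ ψ
  Δ-mp {φ} {ψ} φ⇒ψ∈ φ∈ with Δ-complete ψ
  ... | inj₁ ψ∈  = ψ∈
  ... | inj₂ ¬ψ∈ = ⊥-elim (Δ-consistent (_ ∷ _ ∷ _ ∷ [] , φ⇒ψ∈ ∷ φ∈ ∷ ¬ψ∈ ∷ [] ,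
                     ⊢-schema (¬ˢ ((# 0 ⇒ˢ # 1) ∧ˢ # 0 ∧ˢ ¬ˢ # 1 ∧ˢ ⊤ˢ)) (φ ∷ ψ ∷ [])))

  Δ-closed : ∀ {φ ψ} → ⊢ φ ⇒ ψ → Δ φ → Δ ψ
  Δ-closed = Δ-mp ∘ Δ-theorem

  Δ-closed₂ : ∀ {φ ψ χ} → ⊢ φ ⇒ ψ ⇒ χ → Δ φ → Δ ψ → Δ χ
  Δ-closed₂ h φ∈ = Δ-mp (Δ-closed h φ∈)

  Δ-¬ : ∀ {φ} → Δ (¬ᶠ φ) → ¬ Δ φ
  Δ-¬ {φ} ¬φ∈ φ∈ = Δ-consistent (_ ∷ _ ∷ [] , ¬φ∈ ∷ φ∈ ∷ [] , ⊢-schema (¬ˢ (¬ˢ # 0 ∧ˢ # 0 ∧ˢ ⊤ˢ)) (φ ∷ []))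

  Δ-¬⁺ : ∀ {φ} → ¬ Δ φ → Δ (¬ᶠ φ)
  Δ-¬⁺ {φ} φ∉ with Δ-complete φ
  ... | inj₁ φ∈  = ⊥-elim (φ∉ φ∈)
  ... | inj₂ ¬φ∈ = ¬φ∈

  Δ-∧ : ∀ {φ ψ} → Δ (φ ∧ᶠ ψ) → Δ φ × Δ ψ
  Δ-∧ {φ} {ψ} φ∧ψ∈ = Δ-closed (⊢-schema (# 0 ∧ˢ # 1 ⇒ˢ # 0) (φ ∷ ψ ∷ [])) φ∧ψ∈
                   , Δ-closed (⊢-schema (# 0 ∧ˢ # 1 ⇒ˢ # 1) (φ ∷ ψ ∷ [])) φ∧ψ∈

  Δ-∧⁺ : ∀ {φ ψ} → Δ φ → Δ ψ → Δ (φ ∧ᶠ ψ)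
  Δ-∧⁺ {φ} {ψ} = Δ-closed₂ (⊢-schema (# 0 ⇒ˢ # 1 ⇒ˢ # 0 ∧ˢ # 1) (φ ∷ ψ ∷ []))

  Δ-at-closed : ∀ n {φ ψ} → ⊢ φ ⇒ ψ → Δ (at n φ) → Δ (at n ψ)
  Δ-at-closed n {φ} {ψ} h = Δ-closed (mp (at-K n φ ψ) (nec-at n h))

  Δ-at-closed₂ : ∀ n {φ ψ χ} → ⊢ φ ⇒ ψ ⇒ χ → Δ (at n φ) → Δ (at n ψ) → Δ (at n χ)
  Δ-at-closed₂ n {φ} {ψ} {χ} h = Δ-closed₂ (⇒-trans (mp (at-K n φ (ψ ⇒ χ)) (nec-at n h)) (at-K n ψ χ))

  Δ-at-⊤ : ∀ n → Δ (at n ⊤ᶠ)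
  Δ-at-⊤ n = Δ-theorem (nec-at n (⊢-schema ⊤ˢ []))

  Δ-at-¬ : ∀ n {φ} → Δ (at n (¬ᶠ φ)) → ¬ Δ (at n φ)
  Δ-at-¬ n {φ} = Δ-¬ ∘ Δ-closed (⇔-from (at-selfdual n φ))

  Δ-at-¬⁺ : ∀ n {φ} → ¬ Δ (at n φ) → Δ (at n (¬ᶠ φ))
  Δ-at-¬⁺ n {φ} = Δ-closed (⇔-to (at-selfdual n φ)) ∘ Δ-¬⁺

  Δ-at-∧ : ∀ n {φ ψ} → Δ (at n (φ ∧ᶠ ψ)) → Δ (at n φ) × Δ (at n ψ)
  Δ-at-∧ n {φ} {ψ} h = Δ-at-closed n (⊢-schema (# 0 ∧ˢ # 1 ⇒ˢ # 0) (φ ∷ ψ ∷ [])) h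
                     , Δ-at-closed n (⊢-schema (# 0 ∧ˢ # 1 ⇒ˢ # 1) (φ ∷ ψ ∷ [])) h

  Δ-at-∧⁺ : ∀ n {φ ψ} → Δ (at n φ) → Δ (at n ψ) → Δ (at n (φ ∧ᶠ ψ))
  Δ-at-∧⁺ n {φ} {ψ} = Δ-at-closed₂ n (⊢-schema (# 0 ⇒ˢ # 1 ⇒ˢ # 0 ∧ˢ # 1) (φ ∷ ψ ∷ []))

  Δ-at-at : ∀ m n {φ} → Δ (at m (at n φ)) → Δ (at n φ)
  Δ-at-at m n {φ} = Δ-closed (at-agree m n φ)

  Δ-at-at⁺ : ∀ m n {φ} → Δ (at n φ) → Δ (at m (at n φ))
  Δ-at-at⁺ m n {φ} h with Δ-complete (at m (at n φ))
  ... | inj₁ h′ = h′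
  ... | inj₂ h′ = ⊥-elim (Δ-at-¬ n (Δ-at-at m n (Δ-at-closed m (⇔-to (at-selfdual n φ))
                                                      (Δ-closed (⇔-to (at-selfdual m (at n φ))) h′))) h)

  _~_ : ℕ → ℕ → Set
  m ~ n = Δ (at m (nom n))

  ~-refl : ∀ n → n ~ n
  ~-refl n = Δ-theorem (at-refl n)

  ~-sym : ∀ {m n} → m ~ n → n ~ m
  ~-sym {m} {n} = Δ-closed (at-sym n m)

  ~-transport : ∀ {m n φ} → m ~ n → Δ (at n φ) → Δ (at m φ)
  ~-transport {m} {n} {φ} m~n φ∈ = Δ-closed (at-nom m n φ) (Δ-∧⁺ m~n φ∈)

  ~-trans : ∀ {l m n} → l ~ m → m ~ n → l ~ n
  ~-trans = ~-transport

  _~?_ : ∀ m n → Dec (m ~ n)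
  m ~? n with Δ-complete (at m (nom n))
  ... | inj₁ m~n  = yes m~n
  ... | inj₂ m≁n  = no (Δ-¬ m≁n)

  Δ-bridge : ∀ {m j k φ ψ} → Δ (at m (⟨B⟩ (nom j) (nom k))) → Δ (at j φ) → Δ (at k ψ) →
             Δ (at m (⟨B⟩ φ ψ))
  Δ-bridge {m} {j} {k} {φ} {ψ} jk∈ φ∈ ψ∈ =
    Δ-at-closed₂ m (bridgeʳ k φ ψ) (Δ-at-at⁺ m k ψ∈)
      (Δ-at-closed₂ m (bridgeˡ j φ (nom k)) (Δ-at-at⁺ m j φ∈) jk∈)

-- A point of the canonical model is the least nominal of its ~-class.
module Canonical (Δ : Pred Formula 0ℓ) (Δ-consistent : Consistent Δ) (Δ-complete : Complete Δ)
                 (Δ-pasted : Pasted Δ) where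
  open MaximalConsistent Δ Δ-consistent Δ-complete public

  private
    representative : ∀ n → Least (n ~_)
    representative n = least (n ~?_) (~-refl n)

  rep : ℕ → ℕ
  rep n = proj₁ (representative n)

  ~rep : ∀ n → n ~ rep n
  ~rep n = proj₁ (proj₂ (representative n))

  ~⇒rep≡ : ∀ {m n} → m ~ n → rep m ≡ rep n
  ~⇒rep≡ {m} {n} m~n = ≤-antisym (proj₂ (proj₂ (representative m)) (~-trans m~n (~rep n)))
                                 (proj₂ (proj₂ (representative n)) (~-trans (~-sym m~n) (~rep m)))

  rep-idem : ∀ n → rep (rep n) ≡ rep n
  rep-idem n = ~⇒rep≡ (~-sym (~rep n))

  W : Set
  W = Σ ℕ λ n → rep n ≡ n

  W-≡ : ∀ {m n} (p : rep m ≡ m) (q : rep n ≡ n) → m ≡ n → _≡_ {A = W} (m , p) (n , q)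
  W-≡ p q refl = cong (_ ,_) (≡-irrelevant p q)

  point : ℕ → W
  point n = rep n , rep-idem n

  betweenΔ : W → W → W → Set
  betweenΔ (m , _) (n , _) (k , _) = Δ (at n (⟨B⟩ (nom m) (nom k)))

  canonicalFrame : Frame
  canonicalFrame = record { W = W ; B = betweenΔ }

  canonicalV : ℕ → W → Set
  canonicalV p (n , _) = Δ (at n (var p))

  canonicalModel : Model ℕ
  canonicalModel = record { frame = canonicalFrame ; V = canonicalV ; ν = point }

  mutual
    truth⁺ : ∀ φ w → Sat canonicalModel w φ → Δ (at (proj₁ w) φ)
    truth⁺ ⊤ᶠ        (n , _) _                       = Δ-at-⊤ n
    truth⁺ (var p)   _       s                       = s
    truth⁺ (nom n)   _       refl                    = ~-sym (~rep n)
    truth⁺ (¬ᶠ φ)    (n , r) s                       = Δ-at-¬⁺ n (s ∘ truth⁻ φ (n , r))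
    truth⁺ (φ ∧ᶠ ψ)  (n , r) (sφ , sψ)               = Δ-at-∧⁺ n (truth⁺ φ (n , r) sφ) (truth⁺ ψ (n , r) sψ)
    truth⁺ (⟨B⟩ φ ψ) _       (x , y , sφ , sψ , xwy) = Δ-bridge xwy (truth⁺ φ x sφ) (truth⁺ ψ y sψ)
    truth⁺ (at m φ)  (n , _) s                       = Δ-at-at⁺ n m (~-transport (~rep m) (truth⁺ φ (point m) s))

    truth⁻ : ∀ φ w → Δ (at (proj₁ w) φ) → Sat canonicalModel w φ
    truth⁻ ⊤ᶠ        _       _ = tt
    truth⁻ (var p)   _       h = h
    truth⁻ (nom m)   (n , r) h = W-≡ (rep-idem m) r (trans (sym (~⇒rep≡ h)) r)
    truth⁻ (¬ᶠ φ)    (n , r) h = Δ-at-¬ n h ∘ truth⁺ φ (n , r)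
    truth⁻ (φ ∧ᶠ ψ)  (n , r) h = truth⁻ φ (n , r) (proj₁ (Δ-at-∧ n h)) , truth⁻ ψ (n , r) (proj₂ (Δ-at-∧ n h))
    truth⁻ (⟨B⟩ φ ψ) (n , r) h with Δ-pasted h refl
    ... | j , k , w∈ with Δ-∧ w∈
    ... | jk∈ , φψ∈ with Δ-∧ φψ∈
    ... | φ∈ , ψ∈ = point j , point k
                  , truth⁻ φ (point j) (~-transport (~-sym (~rep j)) φ∈)
                  , truth⁻ ψ (point k) (~-transport (~-sym (~rep k)) ψ∈)
                  , Δ-bridge jk∈ (~rep j) (~rep k)
    truth⁻ (at m φ)  (n , _) h = truth⁻ φ (point m) (~-transport (~-sym (~rep m)) (Δ-at-at n m h))

  canonical-named : Named canonicalModel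
  canonical-named (n , r) = n , W-≡ (rep-idem n) r r

  canonical-countable : Countable W
  canonical-countable = proj₁ , λ {(m , p)} {(n , q)} → W-≡ p q

  theorems-true : TheoremsTrue canonicalModel
  theorems-true {φ} ⊢φ w = truth⁻ φ w (Δ-theorem (nec-at (proj₁ w) ⊢φ))

  Δ-true-at : ∀ {n φ} → Δ (nom n) → Δ φ → Sat canonicalModel (point n) φ
  Δ-true-at {n} {φ} n∈ φ∈ =
    truth⁻ φ (point n) (~-transport (~-sym (~rep n)) (Δ-closed (at-intro n φ) (Δ-∧⁺ n∈ φ∈)))

module BetweennessFrame (em : ExcludedMiddle 0ℓ) (F : Frame)
  (hb1 : ValidOn F HB1) (hb2 : ValidOn F HB2) (hb3 : ValidOn F HB3) (hb4 : ValidOn F HB4)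
  (hb5 : ValidOn F HB5) (hb6 : ValidOn F HB6) (hb7 : ValidOn F HB7) (hb8 : ValidOn F HB8') where
  open Frame F

  nominals : W → W → W → W → ℕ → W
  nominals a b c d 0                   = a
  nominals a b c d 1                   = b
  nominals a b c d 2                   = c
  nominals a b c d (suc (suc (suc _))) = d

  noVars : ℕ → W → Set
  noVars _ _ = ⊥

  classical-mp : ∀ {A B : Set} → ¬ (A × ¬ B) → A → B
  classical-mp ¬[a×¬b] a = em⇒dne em (λ ¬b → ¬[a×¬b] (a , ¬b))

  classical-∨ : ∀ {A B : Set} → ¬ (¬ A × ¬ B) → A ⊎ B
  classical-∨ {A} ¬¬A⊎B with em {A}
  ... | yes a = inj₁ a
  ... | no ¬a = inj₂ (em⇒dne em (λ ¬b → ¬¬A⊎B (¬a , ¬b)))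

  distinct : ∀ {x y z} → B x y z → Distinct x y z
  distinct {x} {y} {z} b with classical-mp (hb1 noVars (nominals y x z y) y) (x , z , refl , refl , b)
  ... | x≢y , z≢y , x≢z = x≢y , z≢y ∘ sym , x≢z

  left≢mid : ∀ {x y z} → B x y z → x ≢ y
  left≢mid = proj₁ ∘ distinct

  mid≢right : ∀ {x y z} → B x y z → y ≢ z
  mid≢right = proj₁ ∘ proj₂ ∘ distinct

  left≢right : ∀ {x y z} → B x y z → x ≢ z
  left≢right = proj₂ ∘ proj₂ ∘ distinct

  symmetric : ∀ {x y z} → B x y z → B z y x
  symmetric {x} {y} {z} b with classical-mp (hb2 noVars (nominals x z z z) y) (x , z , refl , refl , b)
  ... | _ , _ , refl , refl , b′ = b′

  asymmetric : ∀ {x y z} → B x y z → ¬ B x z y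
  asymmetric {x} {y} {z} b b′ =
    classical-mp (hb3 noVars (nominals x y z z) y) (x , z , refl , refl , b) (x , y , refl , refl , b′)

  outer-transitive : ∀ {x y z u} → B x y z → B y z u → B x y u × B x z u
  outer-transitive {x} {y} {z} {u} b b′
    with classical-mp (hb4 noVars (nominals x y z u) y) ((x , z , refl , refl , b) , (y , u , refl , refl , b′))
  ... | (_ , _ , refl , refl , c) , (_ , _ , refl , refl , c′) = c , c′

  inner-transitive : ∀ {x y z u} → B x y z → B y u z → B x y u
  inner-transitive {x} {y} {z} {u} b b′
    with classical-mp (hb5 noVars (nominals z y x u) y) ((z , x , refl , refl , symmetric b) , (z , y , refl , refl , symmetric b′))
  ... | _ , (_ , _ , refl , refl , c) = symmetric c

  connected : ∀ {x y z} → Distinct x y z → B x y z ⊎ B x z y ⊎ B y x z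
  connected {x} {y} {z} (x≢y , y≢z , x≢z)
    with classical-∨ (classical-mp (hb6 noVars (nominals x y z z) y) (x≢y ∘ sym , x≢z ∘ sym , y≢z))
  ... | inj₁ (_ , _ , refl , refl , b) = inj₁ b
  ... | inj₂ rest with classical-∨ rest
  ... | inj₁ (_ , _ , refl , refl , b) = inj₂ (inj₁ b)
  ... | inj₂ (_ , _ , refl , refl , b) = inj₂ (inj₂ b)

  between-some : ∀ y → Σ W λ x → Σ W λ z → B x y z
  between-some y with hb7 noVars (nominals y y y y) y
  ... | x , z , _ , _ , b = x , z , b

  between-endpoints : ∀ {s t u} → Sat (model F noVars (nominals s t t t)) u (C (nom 0 ∨ᶠ nom 1)) → B s u t
  between-endpoints (p , q , sp , sq , b) with classical-∨ sp | classical-∨ sq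
  ... | inj₁ refl | inj₁ refl = ⊥-elim (left≢right b refl)
  ... | inj₁ refl | inj₂ refl = b
  ... | inj₂ refl | inj₁ refl = symmetric b
  ... | inj₂ refl | inj₂ refl = ⊥-elim (left≢right b refl)

  -- (HB8′) puts x strictly between two points u, v of the open segment (s,t);
  -- one of them lies between x and t.
  right-dense : ∀ {s x t} → B s x t → Σ W λ y → B x y t
  right-dense {s} {x} {t} bsxt
    with classical-mp (hb8 noVars (nominals s t t t) x) (s , t , refl , refl , bsxt)
  ... | u , v , cu , cv , buxv = choose (between-endpoints cu) (between-endpoints cv)
    where
    x≢t : x ≢ t
    x≢t = mid≢right bsxt

    not-beyond : ∀ {w} → B s w t → ¬ B x t w
    not-beyond bswt bxtw = asymmetric bswt (proj₂ (outer-transitive bsxt bxtw))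

    choose : B s u t → B s v t → Σ W λ y → B x y t
    choose bsut bsvt with connected (mid≢right buxv , mid≢right bsvt , x≢t)
    ... | inj₁ bxvt        = v , bxvt
    ... | inj₂ (inj₁ bxtv) = ⊥-elim (not-beyond bsvt bxtv)
    ... | inj₂ (inj₂ bvxt) with connected (left≢mid buxv ∘ sym , mid≢right bsut , x≢t)
    ...   | inj₁ bxut        = u , bxut
    ...   | inj₂ (inj₁ bxtu) = ⊥-elim (not-beyond bsut bxtu)
    ...   | inj₂ (inj₂ buxt) with connected (left≢right buxv , mid≢right bsvt , mid≢right bsut)
    ...     | inj₁ buvt        = ⊥-elim (asymmetric (symmetric bvxt) (inner-transitive (symmetric buvt) (symmetric buxv)))
    ...     | inj₂ (inj₁ butv) = ⊥-elim (asymmetric bvxt (inner-transitive (symmetric butv) (symmetric buxt)))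
    ...     | inj₂ (inj₂ bvut) = ⊥-elim (asymmetric (symmetric buxt) (inner-transitive (symmetric bvut) buxv))

  dense : ∀ {x z} → x ≢ z → Σ W λ y → B x y z
  dense {x} {z} x≢z with between-some x
  ... | a , b , baxb with em {z ≡ b} | em {z ≡ a}
  ... | yes refl | _        = right-dense baxb
  ... | no _     | yes refl = right-dense (symmetric baxb)
  ... | no _     | no z≢a with connected (left≢mid baxb , x≢z , z≢a ∘ sym)
  ... | inj₁ baxz        = right-dense baxz
  ... | inj₂ (inj₁ bazx) = right-dense (inner-transitive (symmetric baxb) (symmetric bazx))
  ... | inj₂ (inj₂ bxaz) = right-dense (proj₁ (outer-transitive (symmetric baxb) bxaz))

betweenness-DLBWE : ExcludedMiddle 0ℓ → (F : Frame) → All (ValidOn F) BetweennessAxioms → DLBWE F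
betweenness-DLBWE em F (hb1 ∷ hb2 ∷ hb3 ∷ hb4 ∷ hb5 ∷ hb6 ∷ hb7 ∷ hb8 ∷ []) = record
  { B1 = distinct ; B2 = symmetric ; B3 = asymmetric ; B4 = λ b b′ → proj₁ (outer-transitive b b′)
  ; B5 = inner-transitive ; B6 = connected ; B7 = between-some ; B8 = dense }
  where open BetweennessFrame em F hb1 hb2 hb3 hb4 hb5 hb6 hb7 hb8

module Completeness (em : ExcludedMiddle 0ℓ) (Γ : Pred Formula 0ℓ) (Γ-consistent : Consistent Γ) where
  open Lindenbaum em (namedCopy Γ) (namedCopy-consistent Γ-consistent) namedCopy-fresh
  open Canonical Δ Δ-consistent Δ-complete Δ-pasted public

  ν₀ : ℕ → W
  ν₀ = point ∘ double

  baseModel : Model ℕ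
  baseModel = model canonicalFrame canonicalV ν₀

  expandedModel : Model (ℕ ⊎ ℕ)
  expandedModel = model canonicalFrame canonicalV [ ν₀ , point ]

  Γ-true : ∀ φ → Γ φ → Sat baseModel (point 1) φ
  Γ-true φ φ∈Γ = sat-mapNom⁻ canonicalFrame canonicalV double (λ _ → refl) φ
                   (Δ-true-at (Γ⊆Δ (inj₂ refl)) (Γ⊆Δ (inj₁ (φ , φ∈Γ , refl))))

  Γ-true-expanded : ∀ φ → Γ φ → Sat expandedModel (point 1) (embed φ)
  Γ-true-expanded φ φ∈Γ = sat-mapNom⁺ canonicalFrame canonicalV inj₁ (λ _ → refl) φ (Γ-true φ φ∈Γ)

  expanded-named : Named expandedModel
  expanded-named w = inj₂ (proj₁ (canonical-named w)) , proj₂ (canonical-named w)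

  canonical-betweenness : All (ValidOn canonicalFrame) BetweennessAxioms
  canonical-betweenness = betweenness-valid canonicalModel canonical-named theorems-true

theorem7p10 : ExcludedMiddle 0ℓ →
    (Γ : Form ℕ → Set) → Consistent Γ →
    (Σ (Model (ℕ ⊎ ℕ)) λ M →
        Countable (Model.W M) × Named M
        × All (ValidOn (Model.frame M)) BetweennessAxioms
        × SatisfiedIn M Γ)
    × (Σ Frame λ F → Countable (Frame.W F) × DLBWE F × SatisfiableOn F Γ)
theorem7p10 em Γ Γ-consistent =
    (expandedModel , canonical-countable , expanded-named , canonical-betweenness , point 1 , Γ-true-expanded)
  , (canonicalFrame , canonical-countable , betweenness-DLBWE em canonicalFrame canonical-betweenness
    , canonicalV , ν₀ , point 1 , Γ-true)
  where open Completeness em Γ Γ-consistent
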